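{- Let $n$ be a positive integer and $S \subseteq \mathbb{Z}_{2n}^2$ with $|S| = 4n+1$. Let $a_1,\dots,a_t$ (with $t \le 2n$) be the distinct first coordinates of elements of $S$, and let $A_i = \{y : (a_i,y) \in S\}$ for $1\le i\le t$. Suppose that there are integers $1 \le k_i \le 2n$ with $k_1+\cdots+k_t = 2n$, $k_1a_1+\cdots+k_ta_t = 0$ in $\mathbb{Z}_{2n}$, and $0 \in A_1\,\psi^{k_1-1}A_1 + A_2\,\psi^{k_2-1}A_2+\cdots+A_t\,\psi^{k_t-1}A_t$. Then there exist $2n$ elements of $S$ whose sum is $(0,0)$.
   Context: For $A\subseteq\mathbb{Z}_{2n}$ and a positive integer $k$, $A\,\psi^{k-1}A$ denotes the set of elements of $\mathbb{Z}_{2n}$ that can be written as a sum of $k$ distinct elements of $A$ (empty if $k>|A|$). Sums of sets are Minkowski sums. -}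

module Defs where

open import Data.Nat using (ℕ; _+_; _*_)
open import Data.Fin using (Fin; toℕ; _≟_)
open import Data.Product using (_×_; _,_; proj₁; proj₂; ∃; ∃-syntax; Σ-syntax)
open import Data.List using (List; map; filter; length; tabulate)
open import Data.Nat.ListAction using (sum)
open import Data.List.Relation.Binary.Sublist.Propositional using (_⊆_)
open import Relation.Binary.PropositionalEquality using (_≡_)

ℤ[_] : ℕ → Set
ℤ[ m ] = Fin m

Cong[mod_] : ℕ → ℕ → ℕ → Set
Cong[mod m ] a b = ∃[ p ] ∃[ q ] (a + p * m ≡ b + q * m)

sumℕ : ∀ {m} → List (Fin m) → ℕ
sumℕ xs = sum (map toℕ xs)

-- y ∈ A ψ^{k-1} A : y is the sum of k distinct elements of A.
-- A is given as a duplicate-free list; "k distinct elements of A" is a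
-- sublist of A of length k.
_∈RestrictedSumset[_,_] : ∀ {m} → Fin m → List (Fin m) → ℕ → Set
_∈RestrictedSumset[_,_] {m} y A k =
  ∃[ B ] (B ⊆ A × length B ≡ k × Cong[mod m ] (sumℕ B) (toℕ y))

-- A_x = { y : (x , y) ∈ S }, as a list (duplicate-free whenever S is).
fibre : ∀ {m} → List (Fin m × Fin m) → Fin m → List (Fin m)
fibre S x = map proj₂ (filter (λ p → proj₁ p ≟ x) S)

ZeroInMinkowskiSum : ∀ {m t} → (Fin t → Fin m → Set) → Set
ZeroInMinkowskiSum {m} {t} X =
  Σ[ y ∈ (Fin t → Fin m) ] ((∀ i → X i (y i)) × Cong[mod m ] (sum (tabulate (λ i → toℕ (y i)))) 0)

{-# OPTIONS --safe #-}
module Submission where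

-- Each representation of y_i as a sum of k_i distinct elements of the fibre A_i lifts to
-- k_i distinct points of S on the line x = a_i.  Lines over distinct a_i are disjoint, so
-- together these points form a subset T of S with Σ k_i = 2n elements, whose first
-- coordinates sum to Σ k_i a_i ≡ 0 and whose second coordinates sum to Σ y_i ≡ 0.

open import Defs
open import Data.Nat using (ℕ; zero; suc; _+_; _*_; _≤_)
open import Data.Nat.Tactic.RingSolver using (solve-∀)
open import Data.Nat.ListAction using (sum)
open import Data.Nat.ListAction.Properties using (sum-++; sum-↭)
open import Data.Fin using (Fin; toℕ; _≟_; zero; suc)
open import Data.Fin.Properties using (0≢1+n; suc-injective)
open import Data.Product using (_×_; _,_; proj₁; proj₂; ∃-syntax)
open import Data.List using (List; []; _∷_; _++_; map; concat; length; tabulate)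
open import Data.List.Properties using (map-++; map-∘; length-map; length-++; tabulate-cong)
open import Data.List.Membership.Propositional using (_∈_)
open import Data.List.Relation.Unary.All using (All; []; _∷_)
import Data.List.Relation.Unary.All as All
open import Data.List.Relation.Unary.All.Properties using (all-filter; concat⁺; tabulate⁺)
open import Data.List.Relation.Unary.Unique.Propositional using (Unique)
open import Data.List.Relation.Binary.Sublist.Propositional
  using (_⊆_; []; _∷_; _∷ʳ_; minimum; ⊆-trans)
open import Data.List.Relation.Binary.Sublist.Propositional.Properties using (All-resp-⊆; filter-⊆)
open import Data.List.Relation.Binary.Permutation.Propositional
  using (_↭_; refl; prep; trans; ↭-sym)
open import Data.List.Relation.Binary.Permutation.Propositional.Properties
  using (shift; ++⁺ˡ; ↭-length; All-resp-↭; map⁺)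
open import Data.Empty using (⊥; ⊥-elim)
open import Function using (_∘_)
open import Function.Definitions using (Injective)
open import Relation.Binary.PropositionalEquality as ≡ using (_≡_; cong; cong₂)
open ≡.≡-Reasoning

module _ {A : Set} where

  ⊆-map⁻ : ∀ {B : Set} (f : A → B) {ys : List B} {xs : List A} →
    ys ⊆ map f xs → ∃[ zs ] (zs ⊆ xs × map f zs ≡ ys)
  ⊆-map⁻ f {xs = []}     []         = [] , [] , ≡.refl
  ⊆-map⁻ f {xs = x ∷ xs} (_ ∷ʳ τ)   with ⊆-map⁻ f τ
  ... | zs , σ , eq = zs , x ∷ʳ σ , eq
  ⊆-map⁻ f {xs = x ∷ xs} (≡.refl ∷ τ) with ⊆-map⁻ f τ
  ... | zs , σ , eq = x ∷ zs , ≡.refl ∷ σ , cong (f x ∷_) eq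

  ⊆-disjoint-union : ∀ {P Q : A → Set} {xs ys zs : List A} →
    xs ⊆ zs → ys ⊆ zs → All P xs → All Q ys → (∀ {z} → P z → Q z → ⊥) →
    ∃[ us ] (us ⊆ zs × us ↭ xs ++ ys)
  ⊆-disjoint-union [] [] [] [] _ = [] , [] , refl
  ⊆-disjoint-union (z ∷ʳ τ₁) (.z ∷ʳ τ₂) pxs qys P∩Q=∅
    with ⊆-disjoint-union τ₁ τ₂ pxs qys P∩Q=∅
  ... | us , τ , π = us , z ∷ʳ τ , π
  ⊆-disjoint-union (≡.refl ∷ τ₁) (z ∷ʳ τ₂) (_ ∷ pxs) qys P∩Q=∅
    with ⊆-disjoint-union τ₁ τ₂ pxs qys P∩Q=∅
  ... | us , τ , π = z ∷ us , ≡.refl ∷ τ , prep z π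
  ⊆-disjoint-union {xs = xs} {ys = _ ∷ ys} (z ∷ʳ τ₁) (≡.refl ∷ τ₂) pxs (_ ∷ qys) P∩Q=∅
    with ⊆-disjoint-union τ₁ τ₂ pxs qys P∩Q=∅
  ... | us , τ , π = z ∷ us , ≡.refl ∷ τ , trans (prep z π) (↭-sym (shift z xs ys))
  ⊆-disjoint-union (≡.refl ∷ _) (≡.refl ∷ _) (pz ∷ _) (qz ∷ _) P∩Q=∅ = ⊥-elim (P∩Q=∅ pz qz)

  All-concat-tabulate : ∀ {t} {P : Fin t → A → Set} {C : Fin t → List A} →
    (∀ i → All (P i) (C i)) → All (λ z → ∃[ i ] P i z) (concat (tabulate C))
  All-concat-tabulate PC = concat⁺ (tabulate⁺ (λ i → All.map (i ,_) (PC i)))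

  ⊆-disjoint-⋃ : ∀ {t} {P : Fin t → A → Set} {zs : List A} (C : Fin t → List A) →
    (∀ i → C i ⊆ zs) → (∀ i → All (P i) (C i)) → (∀ {i j z} → P i z → P j z → i ≡ j) →
    ∃[ us ] (us ⊆ zs × us ↭ concat (tabulate C))
  ⊆-disjoint-⋃ {t = zero} C _ _ _ = [] , minimum _ , refl
  ⊆-disjoint-⋃ {t = suc t} C C⊆zs PC disjoint
    with ⊆-disjoint-⋃ (C ∘ suc) (C⊆zs ∘ suc) (PC ∘ suc) (λ p q → suc-injective (disjoint p q))
  ... | rest , rest⊆zs , π
    with ⊆-disjoint-union (C⊆zs zero) rest⊆zs (PC zero)
           (All-resp-↭ (↭-sym π) (All-concat-tabulate (PC ∘ suc)))
           (λ p (j , q) → 0≢1+n (disjoint p q))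
  ... | us , us⊆zs , ρ = us , us⊆zs , trans ρ (++⁺ˡ (C zero) π)

  concat-tabulate-additive : ∀ {t} (F : List A → ℕ) →
    F [] ≡ 0 → (∀ xs ys → F (xs ++ ys) ≡ F xs + F ys) →
    (C : Fin t → List A) → F (concat (tabulate C)) ≡ sum (tabulate (F ∘ C))
  concat-tabulate-additive {t = zero} F F[]≡0 _ _ = F[]≡0
  concat-tabulate-additive {t = suc t} F F[]≡0 F-++ C = begin
    F (C zero ++ concat (tabulate (C ∘ suc)))   ≡⟨ F-++ (C zero) _ ⟩
    F (C zero) + F (concat (tabulate (C ∘ suc))) ≡⟨ cong (F (C zero) +_) (concat-tabulate-additive F F[]≡0 F-++ (C ∘ suc)) ⟩
    F (C zero) + sum (tabulate (F ∘ C ∘ suc))   ∎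

  sum-map-↭-concat-tabulate : ∀ {t} (f : A → ℕ) (C : Fin t → List A) {us : List A} →
    us ↭ concat (tabulate C) → sum (map f us) ≡ sum (tabulate (λ i → sum (map f (C i))))
  sum-map-↭-concat-tabulate f C π = ≡.trans (sum-↭ (map⁺ f π))
    (concat-tabulate-additive (sum ∘ map f) ≡.refl
      (λ xs ys → ≡.trans (cong sum (map-++ f xs ys)) (sum-++ (map f xs) (map f ys))) C)

  length-↭-concat-tabulate : ∀ {t} (C : Fin t → List A) {us : List A} →
    us ↭ concat (tabulate C) → length us ≡ sum (tabulate (length ∘ C))
  length-↭-concat-tabulate C π =
    ≡.trans (↭-length π) (concat-tabulate-additive length ≡.refl (λ xs _ → length-++ xs) C)

  sum-map-constant : (f : A → ℕ) {c : ℕ} {xs : List A} →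
    All (λ x → f x ≡ c) xs → sum (map f xs) ≡ length xs * c
  sum-map-constant f []            = ≡.refl
  sum-map-constant f (≡.refl ∷ fxs) = cong (_ +_) (sum-map-constant f fxs)

module _ {m : ℕ} where

  Cong-reflexive : ∀ {a b} → a ≡ b → Cong[mod m ] a b
  Cong-reflexive a≡b = 0 , 0 , cong (_+ 0) a≡b

  Cong-trans : ∀ {a b c} → Cong[mod m ] a b → Cong[mod m ] b c → Cong[mod m ] a c
  Cong-trans {a} {b} {c} (p , q , a≡b) (r , s , b≡c) = p + r , q + s , (begin
    a + (p + r) * m       ≡⟨ regroup a p r m ⟩
    (a + p * m) + r * m   ≡⟨ cong (_+ r * m) a≡b ⟩
    (b + q * m) + r * m   ≡⟨ swap b q r m ⟩
    (b + r * m) + q * m   ≡⟨ cong (_+ q * m) b≡c ⟩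
    (c + s * m) + q * m   ≡⟨ ≡.sym (regroup′ c q s m) ⟩
    c + (q + s) * m       ∎)
    where
    regroup : ∀ x y z w → x + (y + z) * w ≡ (x + y * w) + z * w
    regroup = solve-∀
    swap : ∀ x y z w → (x + y * w) + z * w ≡ (x + z * w) + y * w
    swap = solve-∀
    regroup′ : ∀ x y z w → x + (y + z) * w ≡ (x + z * w) + y * w
    regroup′ = solve-∀

  Cong-+ : ∀ {a b c d} → Cong[mod m ] a b → Cong[mod m ] c d → Cong[mod m ] (a + c) (b + d)
  Cong-+ {a} {b} {c} {d} (p , q , a≡b) (r , s , c≡d) = p + r , q + s , (begin
    a + c + (p + r) * m          ≡⟨ interchange a c p r m ⟩
    (a + p * m) + (c + r * m)    ≡⟨ cong₂ _+_ a≡b c≡d ⟩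
    (b + q * m) + (d + s * m)    ≡⟨ ≡.sym (interchange b d q s m) ⟩
    b + d + (q + s) * m          ∎)
    where
    interchange : ∀ x y z w v → x + y + (z + w) * v ≡ (x + z * v) + (y + w * v)
    interchange = solve-∀

  Cong-sum : ∀ {t} {f g : Fin t → ℕ} → (∀ i → Cong[mod m ] (f i) (g i)) →
    Cong[mod m ] (sum (tabulate f)) (sum (tabulate g))
  Cong-sum {t = zero}  _   = Cong-reflexive ≡.refl
  Cong-sum {t = suc t} f≡g = Cong-+ (f≡g zero) (Cong-sum (f≡g ∘ suc))

  record LineSelection (S : List (Fin m × Fin m)) (x : Fin m) (k : ℕ) (y : Fin m) : Set where
    field
      points       : List (Fin m × Fin m)
      points⊆S     : points ⊆ S
      on-line      : All (λ p → proj₁ p ≡ x) points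
      size         : length points ≡ k
      sum-ordinate : Cong[mod m ] (sum (map (toℕ ∘ proj₂) points)) (toℕ y)

  restrictedSumset⇒lineSelection : (S : List (Fin m × Fin m)) {x y : Fin m} {k : ℕ} →
    y ∈RestrictedSumset[ fibre S x , k ] → LineSelection S x k y
  restrictedSumset⇒lineSelection S {x} {y} (B , B⊆fibre , |B|≡k , ΣB≡y)
    with ⊆-map⁻ proj₂ B⊆fibre
  ... | C , C⊆column , C↦B = record
    { points       = C
    ; points⊆S     = ⊆-trans C⊆column (filter-⊆ onLine? S)
    ; on-line      = All-resp-⊆ C⊆column (all-filter onLine? S)
    ; size         = ≡.trans (≡.sym (length-map proj₂ C)) (≡.trans (cong length C↦B) |B|≡k)
    ; sum-ordinate = ≡.subst (λ z → Cong[mod m ] (sum z) (toℕ y))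
                       (≡.trans (cong (map toℕ) (≡.sym C↦B)) (≡.sym (map-∘ C))) ΣB≡y
    }
    where
    onLine? = λ (p : Fin m × Fin m) → proj₁ p ≟ x

  ⋃-lineSelections : (S : List (Fin m × Fin m)) {t : ℕ} (a : Fin t → Fin m) →
    Injective _≡_ _≡_ a → (k : Fin t → ℕ) (y : Fin t → Fin m) →
    (∀ i → LineSelection S (a i) (k i) (y i)) →
    ∃[ T ] (T ⊆ S × length T ≡ sum (tabulate k) ×
            sumℕ (map proj₁ T) ≡ sum (tabulate (λ i → k i * toℕ (a i))) ×
            Cong[mod m ] (sumℕ (map proj₂ T)) (sum (tabulate (toℕ ∘ y))))
  ⋃-lineSelections S a a-inj k y line =
    T , T⊆S , |T|≡Σk , Σfst≡Σka , Σsnd≡Σy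
    where
    open LineSelection

    union : ∃[ T ] (T ⊆ S × T ↭ concat (tabulate (points ∘ line)))
    union = ⊆-disjoint-⋃ (points ∘ line) (points⊆S ∘ line) (on-line ∘ line)
      (λ p≡aᵢ p≡aⱼ → a-inj (≡.trans (≡.sym p≡aᵢ) p≡aⱼ))

    T : List (Fin m × Fin m)
    T = proj₁ union

    T⊆S : T ⊆ S
    T⊆S = proj₁ (proj₂ union)

    T↭ : T ↭ concat (tabulate (points ∘ line))
    T↭ = proj₂ (proj₂ union)

    sumℕ-map : ∀ (g : Fin m × Fin m → Fin m) →
      sumℕ (map g T) ≡ sum (tabulate (λ i → sum (map (toℕ ∘ g) (points (line i)))))
    sumℕ-map g = ≡.trans (cong sum (≡.sym (map-∘ T)))
      (sum-map-↭-concat-tabulate (toℕ ∘ g) (points ∘ line) T↭)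

    |T|≡Σk : length T ≡ sum (tabulate k)
    |T|≡Σk = ≡.trans (length-↭-concat-tabulate (points ∘ line) T↭)
      (cong sum (tabulate-cong (size ∘ line)))

    Σfst≡Σka : sumℕ (map proj₁ T) ≡ sum (tabulate (λ i → k i * toℕ (a i)))
    Σfst≡Σka = ≡.trans (sumℕ-map proj₁) (cong sum (tabulate-cong λ i →
      ≡.trans (sum-map-constant (toℕ ∘ proj₁) (All.map (cong toℕ) (on-line (line i))))
              (cong (_* toℕ (a i)) (size (line i)))))

    Σsnd≡Σy : Cong[mod m ] (sumℕ (map proj₂ T)) (sum (tabulate (toℕ ∘ y)))
    Σsnd≡Σy = Cong-trans (Cong-reflexive (sumℕ-map proj₂)) (Cong-sum (sum-ordinate ∘ line))

lemma2p6 : (n : ℕ) → 1 ≤ n →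
    (S : List (Fin (2 * n) × Fin (2 * n))) → Unique S → length S ≡ 4 * n + 1 →
    (t : ℕ) → t ≤ 2 * n →
    (a : Fin t → Fin (2 * n)) → Injective _≡_ _≡_ a →
    (∀ p → p ∈ S → ∃[ i ] (a i ≡ proj₁ p)) →
    (∀ i → ∃[ y ] ((a i , y) ∈ S)) →
    (k : Fin t → ℕ) → (∀ i → 1 ≤ k i × k i ≤ 2 * n) →
    sum (tabulate k) ≡ 2 * n →
    Cong[mod 2 * n ] (sum (tabulate (λ i → k i * toℕ (a i)))) 0 →
    ZeroInMinkowskiSum (λ i y → y ∈RestrictedSumset[ fibre S (a i) , k i ]) →
    ∃[ T ] (T ⊆ S × length T ≡ 2 * n ×
            Cong[mod 2 * n ] (sumℕ (map proj₁ T)) 0 ×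
            Cong[mod 2 * n ] (sumℕ (map proj₂ T)) 0)
lemma2p6 n _ S _ _ t _ a a-inj _ _ k _ Σk≡2n Σka≡0 (y , y∈ , Σy≡0)
  with ⋃-lineSelections S a a-inj k y (λ i → restrictedSumset⇒lineSelection S (y∈ i))
... | T , T⊆S , |T|≡Σk , Σfst≡Σka , Σsnd≡Σy =
  T , T⊆S , ≡.trans |T|≡Σk Σk≡2n ,
  Cong-trans (Cong-reflexive Σfst≡Σka) Σka≡0 ,
  Cong-trans Σsnd≡Σy Σy≡0
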